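{- Let $F$ be a tract and $(M_1,\dots,M_s)$ a flag $F$-matroid on $E=\{1,\dots,n\}$. Then its rank $(\mathrm{rk}(M_1),\dots,\mathrm{rk}(M_s))$ is a non-decreasing sequence of natural numbers.
   Context: A tract is a commutative multiplicative monoid $F$ with identity $1$ and absorbing element $0$ such that $F^\times=F\setminus\{0\}$ is a group, together with a subset $N_F\subseteq\mathbb{N}[F^\times]$ (the nullset) such that $0\in N_F$, $1\notin N_F$, there is a unique $\epsilon\in F^\times$ with $1+\epsilon\in N_F$, and $N_F$ is stable under multiplication by $F^\times$. A Grassmann–Plücker function of rank $r$ on $E$ is a map $\varphi:E^r\to F$, not identically zero, alternating (swapping two arguments multiplies the value by $\epsilon$; value $0$ if two arguments coincide), with $\sum_{k=1}^{r+1}\epsilon^k\varphi(y_1,\dots,\widehat{y_k},\dots,y_{r+1})\varphi(y_k,x_1,\dots,x_{r-1})\in N_F$ for all $x_i,y_j\in E$. An $F$-matroid of rank $r$ is a class $[\varphi]$ modulo multiplication by $F^\times$; its rank is $r$. If $M=[\mu]$, $N=[\nu]$ have ranks $r,w$, then $N\twoheadrightarrow M$ means $\sum_{k=1}^{w+1}\epsilon^k\nu(y_1,\dots,\widehat{y_k},\dots,y_{w+1})\mu(y_k,x_1,\dots,x_{r-1})\in N_F$ for all $y_1,\dots,y_{w+1},x_1,\dots,x_{r-1}\in E$. A flag $F$-matroid is a sequence $(M_1,\dots,M_s)$ of $F$-matroids on $E$ with $M_j\twoheadrightarrow M_i$ for all $1\le i<j\le s$. -}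

module Defs where

open import Level using (0ℓ)
open import Data.Nat using (ℕ; zero; suc)
open import Data.Fin using (Fin; toℕ; punchIn; _<_)
open import Data.Fin.Permutation.Components using (transpose)
open import Data.Vec using (Vec; _∷_; lookup; tabulate)
open import Data.List using (List; []; _∷_; map)
import Data.List as List
open import Data.List.Relation.Unary.All using (All)
open import Data.List.Relation.Binary.Permutation.Propositional using (_↭_)
open import Data.Product using (Σ; ∃; _×_; _,_)
open import Relation.Binary.PropositionalEquality using (_≡_; _≢_)
open import Relation.Nullary using (¬_)

-- An element of ℕ[F^×] (a finite formal sum with natural coefficients)
-- is represented by a list of elements of F^×, considered up to
-- permutation (the nullset is required to be permutation invariant).

record Tract : Set₁ where
  infixl 7 _·_
  field
    Carrier  : Set
    _·_      : Carrier → Carrier → Carrier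
    1#       : Carrier
    0#       : Carrier
    ·-assoc  : ∀ a b c → (a · b) · c ≡ a · (b · c)
    ·-comm   : ∀ a b → a · b ≡ b · a
    ·-identityˡ : ∀ a → 1# · a ≡ a
    ·-zeroˡ  : ∀ a → 0# · a ≡ 0#
    1≢0      : 1# ≢ 0#
    ·-nonzero : ∀ a b → a ≢ 0# → b ≢ 0# → a · b ≢ 0#
    inverse  : ∀ a → a ≢ 0# → Σ Carrier λ b → a · b ≡ 1#
    Null      : List Carrier → Set
    Null-units : ∀ xs → Null xs → All (λ x → x ≢ 0#) xs
    Null-perm : ∀ xs ys → xs ↭ ys → Null xs → Null ys
    Null-zero : Null []
    Null-one  : ¬ Null (1# ∷ [])
    ε         : Carrier
    ε≢0       : ε ≢ 0#
    Null-ε    : Null (1# ∷ ε ∷ [])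
    ε-unique  : ∀ e → e ≢ 0# → Null (1# ∷ e ∷ []) → e ≡ ε
    Null-scale : ∀ a xs → a ≢ 0# → Null xs → Null (map (a ·_) xs)

module _ (F : Tract) where
  open Tract F

  ε^ : ℕ → Carrier
  ε^ zero    = 1#
  ε^ (suc k) = ε · ε^ k

  -- Drop0 xs ys : ys is the list xs with its zero terms removed,
  -- i.e. the element of ℕ[F^×] represented by the formal sum of xs.
  data Drop0 : List Carrier → List Carrier → Set where
    d[]   : Drop0 [] []
    dzero : ∀ {x xs ys} → x ≡ 0# → Drop0 xs ys → Drop0 (x ∷ xs) ys
    dkeep : ∀ {x xs ys} → x ≢ 0# → Drop0 xs ys → Drop0 (x ∷ xs) (x ∷ ys)

  InN : List Carrier → Set
  InN xs = Σ (List Carrier) λ ys → Drop0 xs ys × Null ys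

  -- Σ_{k=1}^{w+1} ε^k ν(y₁,…,ŷ_k,…,y_{w+1}) μ(y_k,x₁,…,x_{r-1}) ∈ N_F
  -- (for rank r = 0 the expression is not defined, and the condition is vacuous)
  GPRel : ∀ {E : Set} (w r : ℕ) → (Vec E w → Carrier) → (Vec E r → Carrier) → Set
  GPRel {E} w zero    ν μ = Data.Unit.⊤
    where import Data.Unit
  GPRel {E} w (suc m) ν μ =
    ∀ (y : Vec E (suc w)) (x : Vec E m) →
      InN (List.tabulate λ (k : Fin (suc w)) →
             ε^ (suc (toℕ k)) · ν (tabulate (λ j → lookup y (punchIn k j)))
                               · μ (lookup y k ∷ x))

  record IsGP (n r : ℕ) (φ : Vec (Fin n) r → Carrier) : Set where
    field
      nonzero    : Σ (Vec (Fin n) r) λ x → φ x ≢ 0#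
      alt-swap   : ∀ (x : Vec (Fin n) r) (i j : Fin r) → i ≢ j →
                     φ (tabulate (λ m → lookup x (transpose i j m))) ≡ ε · φ x
      alt-repeat : ∀ (x : Vec (Fin n) r) (i j : Fin r) → i ≢ j →
                     lookup x i ≡ lookup x j → φ x ≡ 0#
      gp         : GPRel r r φ φ

  -- An F-matroid on E = {1,…,n}, given by a representative GP function
  -- (the class [φ] modulo F^×); its rank is r.
  record FMatroid (n : ℕ) : Set where
    field
      rank : ℕ
      φ    : Vec (Fin n) rank → Carrier
      isGP : IsGP n rank φ

  open FMatroid

  _↠_ : ∀ {n} → FMatroid n → FMatroid n → Set
  N ↠ M = GPRel (rank N) (rank M) (φ N) (φ M)

  IsFlag : ∀ {n s} → (Fin s → FMatroid n) → Set
  IsFlag {s = s} M = ∀ (i j : Fin s) → i < j → M j ↠ M i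

-- If N ↠ M with rk N < rk M, fix z with ν(z) ≠ 0 and any x with μ(x) ≠ 0.
-- As x has more distinct entries than z, some entry x₀ of x lies outside
-- z; moving it to the front and applying the relation to y = x₀ ∷ z, the
-- term k = 1 is nonzero, and a sum in the nullset cannot have exactly one
-- nonzero term, so some μ(z_k, x₂, …, x_r) ≠ 0 as well.  Exchanging x₀ for
-- z_k strictly enlarges the set of entries of z occurring in x, which
-- cannot happen indefinitely.
module Submission where

open import Defs
open import Data.Nat using (ℕ; _≤_)
open import Data.Fin using (Fin)
import Data.Fin as Fin

open import Data.Nat using (zero; suc; _<_; z≤n)
import Data.Nat.Properties as ℕ
open import Data.Fin using (toℕ; punchIn) renaming (zero to fzero; suc to fsuc)
import Data.Fin.Properties as Finₚ
open import Data.Fin.Subset using (Subset; _∈_; _⊂_; ∣_∣)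
open import Data.Fin.Subset.Properties using (∣p∣≤n; p⊂q⇒∣p∣<∣q∣)
open import Data.Fin.Permutation.Components using (transpose; transpose-inverse)
open import Data.Vec using (Vec; _∷_; lookup; tabulate)
open import Data.Vec.Properties using (lookup∘tabulate; tabulate∘lookup; lookup⇒[]=; []=⇒lookup)
open import Data.List using ([]; _∷_)
open import Data.List.Relation.Unary.Any using (Any; here; there)
open import Data.List.Relation.Unary.Any.Properties using (tabulate⁻)
open import Data.Product using (∃; ∃-syntax; _×_; _,_; proj₁; proj₂)
open import Function using (_∘_)
open import Relation.Nullary using (¬_; Dec; yes; no; does; contradiction)
open import Relation.Nullary.Decidable using (dec-true)
open import Relation.Binary.PropositionalEquality using (_≡_; _≢_; refl; sym; trans; cong; subst)

climb : ∀ {A : Set} (P : A → Set) (f : A → ℕ) →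
        (∀ {x} → P x → ∃[ y ] P y × f x < f y) →
        ∀ {x} → P x → ∀ k → ∃[ y ] P y × k ≤ f y
climb P f grow {x} Px zero    = x , Px , z≤n
climb P f grow Px (suc k) with climb P f grow Px k
... | y , Py , k≤fy with grow Py
...   | y′ , Py′ , fy<fy′ = y′ , Py′ , ℕ.≤-<-trans k≤fy fy<fy′

module _ {n : ℕ} where

  infix 4 _∈ᵥ_ _∉ᵥ_ _∈ᵥ?_

  _∈ᵥ_ : ∀ {r} → Fin n → Vec (Fin n) r → Set
  a ∈ᵥ x = ∃ λ q → lookup x q ≡ a

  _∉ᵥ_ : ∀ {r} → Fin n → Vec (Fin n) r → Set
  a ∉ᵥ x = ¬ a ∈ᵥ x

  _∈ᵥ?_ : ∀ {r} (a : Fin n) (x : Vec (Fin n) r) → Dec (a ∈ᵥ x)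
  a ∈ᵥ? x = Finₚ.any? (λ q → lookup x q Finₚ.≟ a)

  ∈ᵥ-transpose : ∀ {r a} (x : Vec (Fin n) r) (i j : Fin r) →
                 a ∈ᵥ x → a ∈ᵥ tabulate (lookup x ∘ transpose i j)
  ∈ᵥ-transpose x i j (q , xq≡a) =
    transpose j i q ,
    trans (lookup∘tabulate (lookup x ∘ transpose i j) (transpose j i q))
          (trans (cong (lookup x) (transpose-inverse i j)) xq≡a)

  hits : ∀ {w r} → Vec (Fin n) w → Vec (Fin n) r → Subset w
  hits z x = tabulate λ i → does (lookup z i ∈ᵥ? x)

  module _ {w r} (z : Vec (Fin n) w) (x : Vec (Fin n) r) where

    ∈-hits⁺ : ∀ {i} → lookup z i ∈ᵥ x → i ∈ hits z x
    ∈-hits⁺ {i} zi∈x =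
      lookup⇒[]= i (hits z x)
        (trans (lookup∘tabulate _ i) (dec-true (lookup z i ∈ᵥ? x) zi∈x))

    ∈-hits⁻ : ∀ {i} → i ∈ hits z x → lookup z i ∈ᵥ x
    ∈-hits⁻ {i} i∈hits with lookup z i ∈ᵥ? x | trans (sym (lookup∘tabulate _ i)) ([]=⇒lookup i∈hits)
    ... | yes zi∈x | _  = zi∈x
    ... | no  _    | ()

  hits-⊂ : ∀ {w r s} (z : Vec (Fin n) w) (x : Vec (Fin n) r) (x′ : Vec (Fin n) s) →
           (∀ {i} → lookup z i ∈ᵥ x → lookup z i ∈ᵥ x′) →
           ∀ k → lookup z k ∉ᵥ x → lookup z k ∈ᵥ x′ → hits z x ⊂ hits z x′
  hits-⊂ z x x′ z∩x⊆x′ k zk∉x zk∈x′ =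
    (λ i∈p → ∈-hits⁺ z x′ (z∩x⊆x′ (∈-hits⁻ z x i∈p))) ,
    k , ∈-hits⁺ z x′ zk∈x′ , zk∉x ∘ ∈-hits⁻ z x

module _ (F : Tract) where
  open Tract F

  ·-zeroʳ : ∀ a → a · 0# ≡ 0#
  ·-zeroʳ a = trans (·-comm a 0#) (·-zeroˡ a)

  ·≢0⇒ʳ≢0 : ∀ a b → a · b ≢ 0# → b ≢ 0#
  ·≢0⇒ʳ≢0 a b ab≢0 b≡0 = ab≢0 (trans (cong (a ·_) b≡0) (·-zeroʳ a))

  ¬Null-singleton : ∀ a → a ≢ 0# → ¬ Null (a ∷ [])
  ¬Null-singleton a a≢0 null[a] with inverse a a≢0
  ... | b , ab≡1 =
    Null-one (subst (λ t → Null (t ∷ [])) (trans (·-comm b a) ab≡1) (Null-scale b (a ∷ []) b≢0 null[a]))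
    where
    b≢0 : b ≢ 0#
    b≢0 b≡0 = 1≢0 (trans (sym ab≡1) (trans (cong (a ·_) b≡0) (·-zeroʳ a)))

  Drop0-∷⇒Any≢0 : ∀ {xs y ys} → Drop0 F xs (y ∷ ys) → Any (_≢ 0#) xs
  Drop0-∷⇒Any≢0 (dzero _ d)    = there (Drop0-∷⇒Any≢0 d)
  Drop0-∷⇒Any≢0 (dkeep x≢0 _) = here x≢0

  InN-∷⇒Any≢0 : ∀ {x xs} → x ≢ 0# → InN F (x ∷ xs) → Any (_≢ 0#) xs
  InN-∷⇒Any≢0 x≢0 (_ , dzero x≡0 _ , _)            = contradiction x≡0 x≢0
  InN-∷⇒Any≢0 x≢0 (_ ∷ [] , dkeep _ _ , null[x])   = contradiction null[x] (¬Null-singleton _ x≢0)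
  InN-∷⇒Any≢0 x≢0 (_ ∷ _ ∷ _ , dkeep _ d , _)      = Drop0-∷⇒Any≢0 d

  module Exchange {n w m : ℕ}
    (ν : Vec (Fin n) w → Carrier) (μ : Vec (Fin n) (suc m) → Carrier)
    (rel : GPRel F w (suc m) ν μ) (μ-isGP : IsGP F n (suc m) μ)
    (z : Vec (Fin n) w) (νz≢0 : ν z ≢ 0#) (w<r : w < suc m) where

    open IsGP μ-isGP using (alt-swap; alt-repeat)

    NonZero : Vec (Fin n) (suc m) → Set
    NonZero x = μ x ≢ 0#

    some-entry-∉ᵥ : ∀ {x} → NonZero x → ∃ λ p → lookup x p ∉ᵥ z
    some-entry-∉ᵥ {x} μx≢0 with Finₚ.all? (λ p → lookup x p ∈ᵥ? z)
    ... | no ¬all = Finₚ.¬∀⟶∃¬ (suc m) _ (λ p → lookup x p ∈ᵥ? z) ¬all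
    ... | yes all with Finₚ.pigeonhole w<r (proj₁ ∘ all)
    ...   | i , j , i<j , same = contradiction
              (alt-repeat x i j (Finₚ.<⇒≢ i<j) (trans (sym (proj₂ (all i))) (trans (cong (lookup z) same) (proj₂ (all j)))))
              μx≢0

    move-to-front : ∀ {x} p → NonZero x →
                    ∃ λ x̃ → NonZero x̃ × lookup x̃ fzero ≡ lookup x p × (∀ {a} → a ∈ᵥ x → a ∈ᵥ x̃)
    move-to-front {x} p μx≢0 with p Finₚ.≟ fzero
    ... | yes refl = x , μx≢0 , refl , λ a∈x → a∈x
    ... | no p≢0   =
      tabulate (lookup x ∘ transpose fzero p) ,
      (λ μx̃≡0 → ·-nonzero ε (μ x) ε≢0 μx≢0 (trans (sym (alt-swap x fzero p (p≢0 ∘ sym))) μx̃≡0)) ,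
      lookup∘tabulate (lookup x ∘ transpose fzero p) fzero ,
      ∈ᵥ-transpose x fzero p

    exchange : ∀ {x₀ x′} → NonZero (x₀ ∷ x′) → ∃ λ k → NonZero (lookup z k ∷ x′)
    exchange {x₀} {x′} μx≢0 = proj₁ other , ·≢0⇒ʳ≢0 _ _ (proj₂ other)
      where
      term : Fin (suc w) → Carrier
      term k = ε^ F (suc (toℕ k)) · ν (tabulate (lookup (x₀ ∷ z) ∘ punchIn k)) · μ (lookup (x₀ ∷ z) k ∷ x′)
      first≢0 : term fzero ≢ 0#
      first≢0 = ·-nonzero _ _
        (·-nonzero _ _ (·-nonzero ε 1# ε≢0 1≢0) (subst (λ v → ν v ≢ 0#) (sym (tabulate∘lookup z)) νz≢0))
        μx≢0
      other : ∃ λ k → term (fsuc k) ≢ 0#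
      other = tabulate⁻ (InN-∷⇒Any≢0 first≢0 (rel (x₀ ∷ z) x′))

    grow : ∀ {x} → NonZero x → ∃[ x″ ] NonZero x″ × ∣ hits z x ∣ < ∣ hits z x″ ∣
    grow {x} μx≢0 with some-entry-∉ᵥ μx≢0
    ... | p , xp∉z with move-to-front p μx≢0
    ...   | x₀ ∷ x′ , μx̃≢0 , x₀≡xp , x⊆x̃ with exchange μx̃≢0
    ...     | k , μx″≢0 =
      lookup z k ∷ x′ , μx″≢0 ,
      p⊂q⇒∣p∣<∣q∣ (hits-⊂ z x (lookup z k ∷ x′) z∩x⊆x″ k (zk∉x̃ ∘ x⊆x̃) (fzero , refl))
      where
      x₀∉z : x₀ ∉ᵥ z
      x₀∉z (i , zi≡x₀) = xp∉z (i , trans zi≡x₀ x₀≡xp)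
      zk∉x̃ : lookup z k ∉ᵥ x₀ ∷ x′
      zk∉x̃ (fzero , x₀≡zk)  = x₀∉z (k , sym x₀≡zk)
      zk∉x̃ (fsuc q , x′q≡zk) = μx″≢0 (alt-repeat (lookup z k ∷ x′) fzero (fsuc q) (λ ()) (sym x′q≡zk))
      z∩x⊆x″ : ∀ {i} → lookup z i ∈ᵥ x → lookup z i ∈ᵥ lookup z k ∷ x′
      z∩x⊆x″ {i} zi∈x with x⊆x̃ zi∈x
      ... | fzero , x₀≡zi  = contradiction (i , sym x₀≡zi) x₀∉z
      ... | fsuc q , x′q≡zi = fsuc q , x′q≡zi

    ¬NonZero : ∀ {x} → ¬ NonZero x
    ¬NonZero μx≢0 with climb NonZero (∣_∣ ∘ hits z) grow μx≢0 (suc w)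
    ... | y , _ , w<∣hits∣ = ℕ.<⇒≱ w<∣hits∣ (∣p∣≤n (hits z y))

  GPRel⇒rank≤ : ∀ {n w r} {ν : Vec (Fin n) w → Carrier} {μ : Vec (Fin n) r → Carrier} →
                GPRel F w r ν μ → IsGP F n r μ → ∀ z → ν z ≢ 0# → r ≤ w
  GPRel⇒rank≤ {r = zero}  _   _    _ _     = z≤n
  GPRel⇒rank≤ {r = suc m} rel μ-isGP z νz≢0 = ℕ.≮⇒≥ λ w<r →
    Exchange.¬NonZero _ _ rel μ-isGP z νz≢0 w<r (proj₂ (IsGP.nonzero μ-isGP))

  ↠⇒rank≤ : ∀ {n} (N M : FMatroid F n) → _↠_ F N M → FMatroid.rank M ≤ FMatroid.rank N
  ↠⇒rank≤ N M N↠M with IsGP.nonzero (FMatroid.isGP N)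
  ... | z , νz≢0 = GPRel⇒rank≤ N↠M (FMatroid.isGP M) z νz≢0

corollary2p9 : (F : Tract) (n s : ℕ) (M : Fin s → FMatroid F n) →
    IsFlag F M → ∀ (i j : Fin s) → i Fin.≤ j →
    FMatroid.rank (M i) ≤ FMatroid.rank (M j)
corollary2p9 F n s M flag i j i≤j with i Finₚ.≟ j
... | yes refl = ℕ.≤-refl
... | no i≢j   = ↠⇒rank≤ F (M j) (M i) (flag i j (Finₚ.≤∧≢⇒< i≤j i≢j))
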